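{- Let $q$ be a prime power and $t\ge2$, $m\ge2$ integers, and let $\varepsilon=(t-1)\bmod q$. Define $$R=q^{m+t-1}\frac{q^m-1+(t-1)(q-1)+(-\varepsilon-1)(q-\varepsilon-1)}{(q^m+(q-1)(t-1)+\varepsilon)(q^m+(q-1)(t-1)+\varepsilon-q)}.$$ Then $$R\le \frac{q^{m+t-1}}{q^m+(t-1)(q-1)}.$$
   Context: Setting: $\mathbf{n}=(1,\dots,1)$, $\mathbf{m}=(m,1,\dots,1)$ of length $t$, ambient space $\operatorname{Mat}(\mathbf{n},\mathbf{m},\mathbb{F}_q)=\mathbb{F}_q^{1\times m}\oplus\mathbb{F}_q^{1\times1}\oplus\cdots\oplus\mathbb{F}_q^{1\times 1}$ with the sum-rank metric. $R$ is the value of the (Ratio-Type eigenvalue) upper bound on $A_q(\mathbf{n},\mathbf{m},3)$ (the largest size of a code with minimum sum-rank distance at least $3$), and $q^{m+t-1}/(q^m+(t-1)(q-1))$ is the Sphere-Packing bound value $|\operatorname{Mat}(\mathbf{n},\mathbf{m},\mathbb{F}_q)|/V_1$, where $V_1$ is the size of a sum-rank ball of radius $1$. The lemma says the Ratio-Type bound is never worse than the Sphere-Packing bound here. -}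

module Defs where

open import Data.Nat using (ℕ; zero; suc; _+_; _*_; _∸_; _^_; _%_)
open import Data.Nat.Primality using (Prime)
open import Data.Integer as ℤ using (ℤ; +_)
open import Data.Rational using (ℚ; 0ℚ; _/_)
open import Data.Product using (Σ; _×_)

IsPrimePower : ℕ → Set
IsPrimePower q = Σ ℕ λ p → Σ ℕ λ k → Prime p × (q ≡′ p ^ suc k)
  where open import Relation.Binary.PropositionalEquality renaming (_≡_ to _≡′_)

-- n mod q (convention n mod 0 = n; never used since q ≥ 2)
_mod′_ : ℕ → ℕ → ℕ
n mod′ zero = n
n mod′ suc k = n % suc k

-- the fraction n / d in ℚ (convention: value 0 when d = 0; never used below
-- since all denominators are positive under the hypotheses)
frac : ℤ → ℕ → ℚ
frac n zero = 0ℚ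
frac n (suc d) = n / suc d

eps : ℕ → ℕ → ℕ
eps q t = (t ∸ 1) mod′ q

D₁ : ℕ → ℕ → ℕ → ℕ
D₁ q m t = q ^ m + (q ∸ 1) * (t ∸ 1) + eps q t

Num : ℕ → ℕ → ℕ → ℤ
Num q m t = (+ (q ^ m) ℤ.- + 1) ℤ.+ + ((t ∸ 1) * (q ∸ 1))
            ℤ.+ (ℤ.- (+ eps q t) ℤ.- + 1) ℤ.* (+ q ℤ.- + eps q t ℤ.- + 1)

-- R = q^(m+t-1) * Num / (D₁ (D₁ - q))
-- (D₁ ≥ q^m ≥ q, so the truncated subtraction D₁ ∸ q is exact)
Rbound : ℕ → ℕ → ℕ → ℚ
Rbound q m t = frac (+ (q ^ (m + t ∸ 1)) ℤ.* Num q m t) (D₁ q m t * (D₁ q m t ∸ q))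

SPbound : ℕ → ℕ → ℕ → ℚ
SPbound q m t = frac (+ (q ^ (m + t ∸ 1))) (q ^ m + (t ∸ 1) * (q ∸ 1))

-- Put V = q^m + (t-1)(q-1), so that D₁ = V + ε, and write q = ε + k with k = q - ε ≥ 0.
-- Then D₁ - q = V - k, and the numerator of R is V - 1 - (ε+1)(k-1); a direct expansion gives
--   (V - 1 - (ε+1)(k-1)) V + ε k (V - 1) = (V + ε)(V - k).
-- As ε k (V - 1) ≥ 0, cross-multiplying the two fractions proves R ≤ q^(m+t-1) / V.
module Submission where

open import Defs
open import Data.Nat using (ℕ; _≤_)
open import Data.Rational using () renaming (_≤_ to _≤ℚ_)

open import Data.Nat as ℕ using (suc; _+_; _*_; _∸_; _^_; _<_; NonZero; s≤s; z≤n)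
import Data.Nat.Properties as ℕ
open import Data.Nat.DivMod using (m%n<n)
open import Data.Nat.Primality using (prime⇒nonZero; prime⇒nonTrivial)
open import Data.Integer as ℤ using (ℤ; +_)
import Data.Integer.Properties as ℤ
open import Data.Integer.Tactic.RingSolver using (solve-∀)
import Data.Rational.Properties as ℚ
import Data.Rational.Unnormalised as ℚᵘ
import Data.Rational.Unnormalised.Properties as ℚᵘ
open import Data.Product using (_,_)
open import Relation.Binary.PropositionalEquality
  using (_≡_; refl; sym; trans; cong; cong₂; subst)

isPrimePower⇒2≤ : ∀ {q} → IsPrimePower q → 2 ≤ q
isPrimePower⇒2≤ (p , k , p-prime , refl) = ℕ.≤-trans 2≤p (ℕ.m≤m*n p (p ^ k))
  where
  instance
    p≢0 = prime⇒nonZero p-prime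
    p^k≢0 = ℕ.m^n≢0 p k
  2≤p : 2 ≤ p
  2≤p = ℕ.nonTrivial⇒n>1 p {{prime⇒nonTrivial p-prime}}

-- Relies on the normalised fraction  n / suc d  being  fromℚᵘ (mkℚᵘ n d)  by definition.
frac-≤ : ∀ a b d e .{{_ : NonZero d}} .{{_ : NonZero e}} →
         a ℤ.* + e ℤ.≤ b ℤ.* + d → frac a d ≤ℚ frac b e
frac-≤ a b (suc d) (suc e) ae≤bd = ℚ.toℚᵘ-cancel-≤
  (ℚᵘ.≤-respʳ-≃ (ℚᵘ.≃-sym (ℚ.toℚᵘ-fromℚᵘ (ℚᵘ.mkℚᵘ b e)))
    (ℚᵘ.≤-respˡ-≃ (ℚᵘ.≃-sym (ℚ.toℚᵘ-fromℚᵘ (ℚᵘ.mkℚᵘ a d))) (ℚᵘ.*≤* ae≤bd)))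

pos-∸ : ∀ {m n} → n ≤ m → + (m ∸ n) ≡ + m ℤ.- + n
pos-∸ {m} {n} n≤m = trans (sym (ℤ.⊖-≥ n≤m)) (sym (ℤ.m-n≡m⊖n m n))

numerator-identity : ∀ (A s e k : ℤ) →
  ((A ℤ.- ℤ.1ℤ) ℤ.+ s ℤ.+ (ℤ.- e ℤ.- ℤ.1ℤ) ℤ.* ((e ℤ.+ k) ℤ.- e ℤ.- ℤ.1ℤ)) ℤ.* (A ℤ.+ s)
    ℤ.+ e ℤ.* k ℤ.* ((A ℤ.+ s) ℤ.- ℤ.1ℤ)
  ≡ (A ℤ.+ s ℤ.+ e) ℤ.* ((A ℤ.+ s ℤ.+ e) ℤ.- (e ℤ.+ k))
numerator-identity = solve-∀

mod′<divisor : ∀ n d .{{_ : NonZero d}} → n mod′ d < d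
mod′<divisor n (suc d) = m%n<n n (suc d)

V₁ : ℕ → ℕ → ℕ → ℕ
V₁ q m t = q ^ m + (t ∸ 1) * (q ∸ 1)

D₁≡V₁+eps : ∀ q m t → D₁ q m t ≡ V₁ q m t + eps q t
D₁≡V₁+eps q m t = cong (λ s → q ^ m + s + eps q t) (ℕ.*-comm (q ∸ 1) (t ∸ 1))

q<q^m : ∀ {q m} → 2 ≤ q → 2 ≤ m → q < q ^ m
q<q^m {q} {m} 2≤q 2≤m =
  subst (_< q ^ m) (ℕ.^-identityʳ q) (ℕ.^-monoʳ-< q 2≤q 2≤m)

module _ {q m : ℕ} (t : ℕ) (2≤q : 2 ≤ q) (2≤m : 2 ≤ m) where

  private
    A s V e k D : ℕ
    A = q ^ m
    s = (t ∸ 1) * (q ∸ 1)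
    V = V₁ q m t
    e = eps q t
    k = q ∸ e
    D = D₁ q m t

    q≢0 : NonZero q
    q≢0 = ℕ.>-nonZero (ℕ.≤-trans (s≤s z≤n) 2≤q)

    q<V : q < V
    q<V = ℕ.<-≤-trans (q<q^m 2≤q 2≤m) (ℕ.m≤m+n A s)

    e≤q : e ≤ q
    e≤q = ℕ.<⇒≤ (mod′<divisor (t ∸ 1) q {{q≢0}})

    q≡e+k : + q ≡ + e ℤ.+ + k
    q≡e+k = trans (cong +_ (sym (ℕ.m+[n∸m]≡n e≤q))) (ℤ.pos-+ e k)

    q<D : q < D
    q<D = subst (q <_) (sym (D₁≡V₁+eps q m t)) (ℕ.<-≤-trans q<V (ℕ.m≤m+n V e))

    V≡A+s : + V ≡ + A ℤ.+ + s
    V≡A+s = ℤ.pos-+ A s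

    D≡A+s+e : + D ≡ + A ℤ.+ + s ℤ.+ + e
    D≡A+s+e = trans (cong +_ (D₁≡V₁+eps q m t)) (trans (ℤ.pos-+ V e) (cong (ℤ._+ + e) V≡A+s))

  instance
    V₁≢0 : NonZero (V₁ q m t)
    V₁≢0 = ℕ.>-nonZero (ℕ.≤-<-trans z≤n q<V)

    D₁[D₁-q]≢0 : NonZero (D₁ q m t * (D₁ q m t ∸ q))
    D₁[D₁-q]≢0 = ℕ.m*n≢0 D (D ∸ q) {{ℕ.>-nonZero (ℕ.≤-<-trans z≤n q<D)}}
                                   {{ℕ.>-nonZero (ℕ.m<n⇒0<n∸m q<D)}}

  Num*V₁≤D₁[D₁-q] : Num q m t ℤ.* + V₁ q m t ℤ.≤ + (D₁ q m t * (D₁ q m t ∸ q))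
  Num*V₁≤D₁[D₁-q] = begin
    Num q m t ℤ.* + V
      ≤⟨ ℤ.i≤i+j _ (+ (e * k * (V ∸ 1))) ⟩
    Num q m t ℤ.* + V ℤ.+ + (e * k * (V ∸ 1))
      ≡⟨ cong₂ ℤ._+_ (cong₂ ℤ._*_ Num≡ V≡A+s) slack≡ ⟩
    _
      ≡⟨ numerator-identity (+ A) (+ s) (+ e) (+ k) ⟩
    (+ A ℤ.+ + s ℤ.+ + e) ℤ.* ((+ A ℤ.+ + s ℤ.+ + e) ℤ.- (+ e ℤ.+ + k))
      ≡⟨ sym denominator≡ ⟩
    + (D * (D ∸ q))
      ∎
    where
    open ℤ.≤-Reasoning
    Num≡ : Num q m t ≡ (+ A ℤ.- ℤ.1ℤ) ℤ.+ + s ℤ.+ (ℤ.- + e ℤ.- ℤ.1ℤ) ℤ.* ((+ e ℤ.+ + k) ℤ.- + e ℤ.- ℤ.1ℤ)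
    Num≡ = cong (λ Q → (+ A ℤ.- ℤ.1ℤ) ℤ.+ + s ℤ.+ (ℤ.- + e ℤ.- ℤ.1ℤ) ℤ.* (Q ℤ.- + e ℤ.- ℤ.1ℤ)) q≡e+k
    slack≡ : + (e * k * (V ∸ 1)) ≡ + e ℤ.* + k ℤ.* ((+ A ℤ.+ + s) ℤ.- ℤ.1ℤ)
    slack≡ = trans (ℤ.pos-* (e * k) (V ∸ 1))
      (cong₂ ℤ._*_ (ℤ.pos-* e k) (trans (pos-∸ (ℕ.≤-<-trans z≤n q<V)) (cong (ℤ._- ℤ.1ℤ) V≡A+s)))
    denominator≡ : + (D * (D ∸ q)) ≡ (+ A ℤ.+ + s ℤ.+ + e) ℤ.* ((+ A ℤ.+ + s ℤ.+ + e) ℤ.- (+ e ℤ.+ + k))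
    denominator≡ = trans (ℤ.pos-* D (D ∸ q))
      (cong₂ ℤ._*_ D≡A+s+e (trans (pos-∸ (ℕ.<⇒≤ q<D)) (cong₂ ℤ._-_ D≡A+s+e q≡e+k)))

lemma5p2 : (q t m : ℕ) → IsPrimePower q → 2 ≤ t → 2 ≤ m →
    Rbound q m t ≤ℚ SPbound q m t
lemma5p2 q t m q-primePower _ 2≤m =
  frac-≤ (+ P ℤ.* Num q m t) (+ P) (D₁ q m t * (D₁ q m t ∸ q)) (V₁ q m t) (begin
    (+ P ℤ.* Num q m t) ℤ.* + V₁ q m t     ≡⟨ ℤ.*-assoc (+ P) (Num q m t) (+ V₁ q m t) ⟩
    + P ℤ.* (Num q m t ℤ.* + V₁ q m t)     ≤⟨ ℤ.*-monoˡ-≤-nonNeg (+ P) (Num*V₁≤D₁[D₁-q] t 2≤q 2≤m) ⟩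
    + P ℤ.* + (D₁ q m t * (D₁ q m t ∸ q))  ∎)
  where
  open ℤ.≤-Reasoning
  P : ℕ
  P = q ^ (m + t ∸ 1)
  2≤q : 2 ≤ q
  2≤q = isPrimePower⇒2≤ q-primePower
  instance
    V₁≢0′ : NonZero (V₁ q m t)
    V₁≢0′ = V₁≢0 t 2≤q 2≤m
    D₁[D₁-q]≢0′ : NonZero (D₁ q m t * (D₁ q m t ∸ q))
    D₁[D₁-q]≢0′ = D₁[D₁-q]≢0 t 2≤q 2≤m
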